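{- Let $\mathcal{B}$ be a tame cartesian bicategory. Then the assignment sending the class of a span $X\xleftarrow{f}A\xrightarrow{g}Y$ in $\mathrm{Map}(\mathcal{B})$ to $f^{op};g$ defines a morphism of cartesian bicategories $F\colon\mathrm{Span}^{\sim}(\mathrm{Map}(\mathcal{B}))\to\mathcal{B}$ which is the identity on objects and full.
   Context: Composition is diagrammatic ($R;S$ means first $R$ then $S$). A cartesian bicategory is a (strict) symmetric monoidal category $(\mathcal{B},\otimes,I)$ with symmetry $\sigma$, enriched over posets (hom-sets ordered by $\le$, with $;$ and $\otimes$ monotone), where every object $X$ has $\delta_X\colon X\to X\otimes X$, $\varepsilon_X\colon X\to I$ such that: (1) they form a cocommutative comonoid; (2) they have right adjoints $\delta_X^*,\varepsilon_X^*$: $\mathrm{id}_X\le\delta_X;\delta_X^*$, $\delta_X^*;\delta_X\le\mathrm{id}$, $\mathrm{id}_X\le\varepsilon_X;\varepsilon_X^*$, $\varepsilon_X^*;\varepsilon_X\le\mathrm{id}_I$; (3) $\delta_X^*;\delta_X=(\mathrm{id}_X\otimes\delta_X);(\delta_X^*\otimes\mathrm{id}_X)$; (4) every $R\colon X\to Y$ satisfies $R;\delta_Y\le\delta_X;(R\otimes R)$ and $R;\varepsilon_Y\le\varepsilon_X$; (5) $\varepsilon_{X\otimes Y}=\varepsilon_X\otimes\varepsilon_Y$, $\delta_{X\otimes Y}=(\delta_X\otimes\delta_Y);(\mathrm{id}\otimes\sigma_{X,Y}\otimes\mathrm{id})$, $\varepsilon_I=\delta_I=\mathrm{id}_I$.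 A morphism of cartesian bicategories is a monoidal functor preserving order and the chosen $\delta,\varepsilon,\delta^*,\varepsilon^*$. $R^{op}=(\mathrm{id}_Y\otimes(\varepsilon_X^*;\delta_X));(\mathrm{id}_Y\otimes R\otimes\mathrm{id}_X);((\delta_Y^*;\varepsilon_Y)\otimes\mathrm{id}_X)$. A map is a morphism $f$ with $\delta_X;(f\otimes f)\le f;\delta_Y$ and $\varepsilon_X\le f;\varepsilon_Y$; $\mathrm{Map}(\mathcal{B})$ is the subcategory of maps (it has finite products given by $\otimes$, $I$). Enough maps: for every $R\colon X\to I$ there is a map $f\colon Z\to X$ with $R=f^{op};\varepsilon_Z$. A weak pullback is a commutative square satisfying the existence (not necessarily uniqueness) part of the pullback universal property. $\mathcal{B}$ is tame if it has enough maps and for all maps $f\colon A\to B$, $g\colon A\to C$, $h\colon B\to D$, $k\colon C\to D$: $h;k^{op}=f^{op};g$ iff the square $f;h=g;k$ is a weak pullback in $\mathrm{Map}(\mathcal{B})$. For a category $\mathcal{C}$ with finite products and weak pullbacks, $\mathrm{Span}^{\sim}(\mathcal{C})$ has the objects of $\mathcal{C}$ and as morphisms $X\to Y$ the classes of spans $X\leftarrow A\to Y$ modulo $\sim$, where $(X\leftarrow A\to Y)\le(X\leftarrow B\to Y)$ iff some $\alpha\colon A\to B$ commutes with both legs and $\sim$ is $\le\cap\ge$; it is ordered by $\le$, composition is via weak pullbacks, $\otimes$ is the product of $\mathcal{C}$, $\delta_X=[X\xleftarrow{\mathrm{id}}X\xrightarrow{\Delta}X\times X]$, $\varepsilon_X=[X\xleftarrow{\mathrm{id}}X\to1]$,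 $\delta^*_X,\varepsilon^*_X$ the reversed spans; it is a cartesian bicategory. -}

module Defs where

open import Level using (Level; _⊔_) renaming (suc to lsuc)
open import Data.Product using (Σ; _×_; _,_; proj₁; proj₂; ∃-syntax)
open import Relation.Binary.PropositionalEquality using (_≡_; refl; sym; trans; cong; subst)
open import Function.Bundles using (_⇔_)

-- The monoidal structure is STRICT: the associativity and unit laws
-- hold as propositional equalities of objects, and on morphisms they
-- hold up to transport along those equalities (transport of an
-- identity along an equality of objects is  coe).
-- Composition is diagrammatic:  R ⨾ S  = first R then S.

record CartesianBicategory (o ℓ e : Level) : Set (lsuc (o ⊔ ℓ ⊔ e)) where
  infixr 9 _⨾_
  infixr 10 _⊗₀_ _⊗₁_
  infix 4 _≤_ _≈_
  field
    Obj : Set o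
    Hom : Obj → Obj → Set ℓ
    _≤_ : ∀ {X Y} → Hom X Y → Hom X Y → Set e
    ≤-refl : ∀ {X Y} {R : Hom X Y} → R ≤ R
    ≤-trans : ∀ {X Y} {R S T : Hom X Y} → R ≤ S → S ≤ T → R ≤ T

  _≈_ : ∀ {X Y} → Hom X Y → Hom X Y → Set e
  R ≈ S = (R ≤ S) × (S ≤ R)

  field
    id : ∀ {X} → Hom X X
    _⨾_ : ∀ {X Y Z} → Hom X Y → Hom Y Z → Hom X Z
    ⨾-mono : ∀ {X Y Z} {R R' : Hom X Y} {S S' : Hom Y Z} →
             R ≤ R' → S ≤ S' → R ⨾ S ≤ R' ⨾ S'
    identityˡ : ∀ {X Y} {R : Hom X Y} → id ⨾ R ≈ R
    identityʳ : ∀ {X Y} {R : Hom X Y} → R ⨾ id ≈ R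
    assoc : ∀ {W X Y Z} {R : Hom W X} {S : Hom X Y} {T : Hom Y Z} →
            (R ⨾ S) ⨾ T ≈ R ⨾ (S ⨾ T)

  coe : ∀ {X Y} → X ≡ Y → Hom X Y
  coe {X} p = subst (Hom X) p id

  field
    I : Obj
    _⊗₀_ : Obj → Obj → Obj
    _⊗₁_ : ∀ {X Y X' Y'} → Hom X Y → Hom X' Y' → Hom (X ⊗₀ X') (Y ⊗₀ Y')
    ⊗-mono : ∀ {X Y X' Y'} {R S : Hom X Y} {R' S' : Hom X' Y'} →
             R ≤ S → R' ≤ S' → R ⊗₁ R' ≤ S ⊗₁ S'
    ⊗-id : ∀ {X Y} → id {X} ⊗₁ id {Y} ≈ id
    ⊗-⨾ : ∀ {X Y Z X' Y' Z'} {R : Hom X Y} {S : Hom Y Z}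
            {R' : Hom X' Y'} {S' : Hom Y' Z'} →
          (R ⨾ S) ⊗₁ (R' ⨾ S') ≈ (R ⊗₁ R') ⨾ (S ⊗₁ S')
    ⊗-assoc₀ : ∀ {X Y Z} → (X ⊗₀ Y) ⊗₀ Z ≡ X ⊗₀ (Y ⊗₀ Z)
    ⊗-unitˡ₀ : ∀ {X} → I ⊗₀ X ≡ X
    ⊗-unitʳ₀ : ∀ {X} → X ⊗₀ I ≡ X
    ⊗-assoc₁ : ∀ {X Y Z X' Y' Z'} {R : Hom X X'} {S : Hom Y Y'} {T : Hom Z Z'} →
               ((R ⊗₁ S) ⊗₁ T) ⨾ coe ⊗-assoc₀ ≈ coe ⊗-assoc₀ ⨾ (R ⊗₁ (S ⊗₁ T))
    ⊗-unitˡ₁ : ∀ {X Y} {R : Hom X Y} → (id {I} ⊗₁ R) ⨾ coe ⊗-unitˡ₀ ≈ coe ⊗-unitˡ₀ ⨾ R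
    ⊗-unitʳ₁ : ∀ {X Y} {R : Hom X Y} → (R ⊗₁ id {I}) ⨾ coe ⊗-unitʳ₀ ≈ coe ⊗-unitʳ₀ ⨾ R

    σ : ∀ {X Y} → Hom (X ⊗₀ Y) (Y ⊗₀ X)
    σ-natural : ∀ {X Y X' Y'} {R : Hom X Y} {R' : Hom X' Y'} →
                (R ⊗₁ R') ⨾ σ ≈ σ ⨾ (R' ⊗₁ R)
    σ-involutive : ∀ {X Y} → σ {X} {Y} ⨾ σ ≈ id
    σ-hexagon : ∀ {X Y Z} →
                σ {X} {Y ⊗₀ Z} ≈
                coe (sym ⊗-assoc₀) ⨾ (σ ⊗₁ id) ⨾ coe ⊗-assoc₀ ⨾ (id ⊗₁ σ) ⨾ coe (sym ⊗-assoc₀)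

    δ : ∀ {X} → Hom X (X ⊗₀ X)
    ε : ∀ {X} → Hom X I
    δ-assoc : ∀ {X} → δ {X} ⨾ (δ ⊗₁ id) ⨾ coe ⊗-assoc₀ ≈ δ ⨾ (id ⊗₁ δ)
    δ-unitˡ : ∀ {X} → δ {X} ⨾ (ε ⊗₁ id) ⨾ coe ⊗-unitˡ₀ ≈ id
    δ-unitʳ : ∀ {X} → δ {X} ⨾ (id ⊗₁ ε) ⨾ coe ⊗-unitʳ₀ ≈ id
    δ-comm : ∀ {X} → δ {X} ⨾ σ ≈ δ

    δ* : ∀ {X} → Hom (X ⊗₀ X) X
    ε* : ∀ {X} → Hom I X
    δ-unit : ∀ {X} → id {X} ≤ δ ⨾ δ*
    δ-counit : ∀ {X} → δ* ⨾ δ ≤ id {X ⊗₀ X}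
    ε-unit : ∀ {X} → id {X} ≤ ε ⨾ ε*
    ε-counit : ∀ {X} → ε* {X} ⨾ ε ≤ id {I}

    frobenius : ∀ {X} → δ* {X} ⨾ δ ≈ (id ⊗₁ δ) ⨾ coe (sym ⊗-assoc₀) ⨾ (δ* ⊗₁ id)

    δ-lax : ∀ {X Y} {R : Hom X Y} → R ⨾ δ ≤ δ ⨾ (R ⊗₁ R)
    ε-lax : ∀ {X Y} {R : Hom X Y} → R ⨾ ε ≤ ε

    ε-⊗ : ∀ {X Y} → ε {X ⊗₀ Y} ≈ (ε ⊗₁ ε) ⨾ coe ⊗-unitˡ₀
    δ-⊗ : ∀ {X Y} →
          δ {X ⊗₀ Y} ≈
          (δ ⊗₁ δ) ⨾ coe (trans ⊗-assoc₀ (cong (X ⊗₀_) (sym ⊗-assoc₀)))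
                   ⨾ (id ⊗₁ (σ ⊗₁ id))
                   ⨾ coe (trans (cong (X ⊗₀_) ⊗-assoc₀) (sym ⊗-assoc₀))
    ε-I : ε {I} ≈ id
    δ-I : δ {I} ≈ coe (sym ⊗-unitˡ₀)

module _ {o ℓ e} (B : CartesianBicategory o ℓ e) where
  open CartesianBicategory B

  op : ∀ {X Y} → Hom X Y → Hom Y X
  op {X} {Y} R =
    coe (sym ⊗-unitʳ₀) ⨾ (id {Y} ⊗₁ (ε* {X} ⨾ δ)) ⨾ coe (sym ⊗-assoc₀)
      ⨾ ((id {Y} ⊗₁ R) ⊗₁ id {X}) ⨾ ((δ* {Y} ⨾ ε) ⊗₁ id {X}) ⨾ coe ⊗-unitˡ₀

  IsMap : ∀ {X Y} → Hom X Y → Set e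
  IsMap f = (δ ⨾ (f ⊗₁ f) ≤ f ⨾ δ) × (ε ≤ f ⨾ ε)

  EnoughMaps : Set (o ⊔ ℓ ⊔ e)
  EnoughMaps = ∀ {X} (R : Hom X I) →
    Σ Obj λ Z → Σ (Hom Z X) λ f → IsMap f × (R ≈ op f ⨾ ε)

  IsWeakPullback : ∀ {A B' C D} → Hom A B' → Hom A C → Hom B' D → Hom C D → Set (o ⊔ ℓ ⊔ e)
  IsWeakPullback {A} {B'} {C} f g h k =
    (f ⨾ h ≈ g ⨾ k) ×
    (∀ {A'} (f' : Hom A' B') (g' : Hom A' C) → IsMap f' → IsMap g' → f' ⨾ h ≈ g' ⨾ k →
       Σ (Hom A' A) λ u → IsMap u × (u ⨾ f ≈ f') × (u ⨾ g ≈ g'))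

  IsTame : Set (o ⊔ ℓ ⊔ e)
  IsTame = EnoughMaps ×
    (∀ {A B' C D} (f : Hom A B') (g : Hom A C) (h : Hom B' D) (k : Hom C D) →
       IsMap f → IsMap g → IsMap h → IsMap k →
       (h ⨾ op k ≈ op f ⨾ g) ⇔ IsWeakPullback f g h k)

  -- Map(B) has weak pullbacks (needed for Span~(Map(B)) to be defined)
  HasWeakPullbacksOfMaps : Set (o ⊔ ℓ ⊔ e)
  HasWeakPullbacksOfMaps = ∀ {B' C D} (h : Hom B' D) (k : Hom C D) → IsMap h → IsMap k →
    Σ Obj λ A → Σ (Hom A B') λ f → Σ (Hom A C) λ g →
      IsMap f × IsMap g × IsWeakPullback f g h k

  -- Spans  X <-left- apex -right-> Y  (representatives of morphisms of
  -- Span~(Map(B)); that the legs are maps is the predicate IsSpanOfMaps)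
  record Span (X Y : Obj) : Set (o ⊔ ℓ) where
    constructor span
    field
      apex : Obj
      left : Hom apex X
      right : Hom apex Y
  open Span public

  IsSpanOfMaps : ∀ {X Y} → Span X Y → Set e
  IsSpanOfMaps s = IsMap (left s) × IsMap (right s)

  _≤ₛ_ : ∀ {X Y} → Span X Y → Span X Y → Set (ℓ ⊔ e)
  s ≤ₛ t = Σ (Hom (apex s) (apex t)) λ α →
    IsMap α × (α ⨾ left t ≈ left s) × (α ⨾ right t ≈ right s)

  idₛ : ∀ X → Span X X
  idₛ X = span X id id

  -- composite of s : X → Y and t : Y → Z computed with the weak pullback
  -- P --p--> apex s, P --q--> apex t  of  right s, left t
  compₛ : ∀ {X Y Z} (s : Span X Y) (t : Span Y Z) {P : Obj} →
          Hom P (apex s) → Hom P (apex t) → Span X Z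
  compₛ s t {P} p q = span P (p ⨾ left s) (q ⨾ right t)

  -- monoidal product: product in Map(B), which is given by ⊗
  _⊗ₛ_ : ∀ {X Y X' Y'} → Span X Y → Span X' Y' → Span (X ⊗₀ X') (Y ⊗₀ Y')
  s ⊗ₛ t = span (apex s ⊗₀ apex t) (left s ⊗₁ left t) (right s ⊗₁ right t)

  σₛ : ∀ X Y → Span (X ⊗₀ Y) (Y ⊗₀ X)
  σₛ X Y = span (X ⊗₀ Y) id σ

  δₛ : ∀ X → Span X (X ⊗₀ X)
  δₛ X = span X id δ

  εₛ : ∀ X → Span X I
  εₛ X = span X id ε

  δ*ₛ : ∀ X → Span (X ⊗₀ X) X
  δ*ₛ X = span X δ id

  ε*ₛ : ∀ X → Span I X
  ε*ₛ X = span X ε id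

  F : ∀ {X Y} → Span X Y → Hom X Y
  F s = op (left s) ⨾ right s

  record FullMorphismFromSpans : Set (o ⊔ ℓ ⊔ e) where
    field
      weakPullbacks : HasWeakPullbacksOfMaps
      -- well-defined on ~-classes and order preserving
      F-mono : ∀ {X Y} (s t : Span X Y) → IsSpanOfMaps s → IsSpanOfMaps t →
               s ≤ₛ t → F s ≤ F t
      F-id : ∀ {X} → F (idₛ X) ≈ id
      F-comp : ∀ {X Y Z} (s : Span X Y) (t : Span Y Z) → IsSpanOfMaps s → IsSpanOfMaps t →
               ∀ {P} (p : Hom P (apex s)) (q : Hom P (apex t)) → IsMap p → IsMap q →
               IsWeakPullback p q (right s) (left t) →
               F (compₛ s t p q) ≈ F s ⨾ F t
      F-⊗ : ∀ {X Y X' Y'} (s : Span X Y) (t : Span X' Y') →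
            IsSpanOfMaps s → IsSpanOfMaps t → F (s ⊗ₛ t) ≈ F s ⊗₁ F t
      F-σ : ∀ {X Y} → F (σₛ X Y) ≈ σ
      F-δ : ∀ {X} → F (δₛ X) ≈ δ
      F-ε : ∀ {X} → F (εₛ X) ≈ ε
      F-δ* : ∀ {X} → F (δ*ₛ X) ≈ δ*
      F-ε* : ∀ {X} → F (ε*ₛ X) ≈ ε*
      F-full : ∀ {X Y} (R : Hom X Y) → Σ (Span X Y) λ s → IsSpanOfMaps s × (F s ≈ R)

module Submission where

-- A map f is left adjoint to f^op. Indeed cup = ε* ⨾ δ and cap = δ* ⨾ ε make
-- every object self-dual (the Frobenius law gives the snake equation), f^op is
-- the mate of f under this duality, and the unit and counit of f ⊣ f^op come
-- from the lax naturality of cap and cup at a map. So op is functorial on maps,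
-- which makes F monotone, monoidal and comonoid preserving; and tameness applied
-- to the weak pullback defining a composite of spans is exactly F-comp.
-- For fullness, enough maps writes the name (R ⊗ id) ⨾ cap of R : X → Y as
-- m^op ⨾ ε for a map m : Z → X ⊗ Y. Bending back, R = π₁^op ⨾ dup₂ ⨾ (m^op ⊗ id) ⨾ π₂,
-- and tameness applied to the weak pullback square m ⨾ dup₂ = ⟨id, m ⨾ π₂⟩ ⨾ (m ⊗ id)
-- rewrites this as (m ⨾ π₁)^op ⨾ (m ⨾ π₂). Weak pullbacks of maps h, k then come
-- from fullness: a span whose image is h ⨾ k^op is a weak pullback by tameness.

open import Defs
open import Level using (Level)
open import Data.Product using (Σ; _×_; _,_; proj₁; proj₂)
open import Relation.Binary.PropositionalEquality using (_≡_; refl; sym; trans; cong; cong₂)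
open import Relation.Binary.Bundles using (Preorder)
open import Relation.Binary.Structures using (IsEquivalence)
open import Axiom.UniquenessOfIdentityProofs.WithK using (uip)
open import Function.Bundles using (Equivalence)
import Relation.Binary.Reasoning.Preorder as PreorderReasoning

module _ {o ℓ e} (B : CartesianBicategory o ℓ e) where
  open CartesianBicategory B

  private variable
    V W X Y Z X' Y' Z' : Obj

  ≈-isEquivalence : IsEquivalence (_≈_ {X} {Y})
  ≈-isEquivalence = record
    { refl = ≤-refl , ≤-refl
    ; sym = λ (p , q) → q , p
    ; trans = λ (p , q) (r , s) → ≤-trans p r , ≤-trans s q
    }

  homPreorder : Obj → Obj → Preorder ℓ e e
  homPreorder X Y = record
    { Carrier = Hom X Y
    ; _≈_ = _≈_
    ; _≲_ = _≤_
    ; isPreorder = record { isEquivalence = ≈-isEquivalence ; reflexive = proj₁ ; trans = ≤-trans }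
    }

  module ≈ {X Y : Obj} = IsEquivalence (≈-isEquivalence {X} {Y})
  module HomReasoning {X Y : Obj} = PreorderReasoning (homPreorder X Y)
  open HomReasoning

  infixr 9 _⟩⨾⟨_
  infixr 10 _⟩⊗⟨_
  infixr 20 refl⟩⨾⟨_
  infixl 20 _⟩⨾⟨refl

  _⟩⨾⟨_ : {R R' : Hom X Y} {S S' : Hom Y Z} → R ≈ R' → S ≈ S' → R ⨾ S ≈ R' ⨾ S'
  (p , p') ⟩⨾⟨ (q , q') = ⨾-mono p q , ⨾-mono p' q'

  _⟩⊗⟨_ : {R S : Hom X Y} {R' S' : Hom X' Y'} → R ≈ S → R' ≈ S' → R ⊗₁ R' ≈ S ⊗₁ S'
  (p , p') ⟩⊗⟨ (q , q') = ⊗-mono p q , ⊗-mono p' q'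

  refl⟩⨾⟨_ : {R : Hom X Y} {S S' : Hom Y Z} → S ≈ S' → R ⨾ S ≈ R ⨾ S'
  refl⟩⨾⟨ p = ≈.refl ⟩⨾⟨ p

  _⟩⨾⟨refl : {R R' : Hom X Y} {S : Hom Y Z} → R ≈ R' → R ⨾ S ≈ R' ⨾ S
  p ⟩⨾⟨refl = p ⟩⨾⟨ ≈.refl

  sym-assoc : {R : Hom W X} {S : Hom X Y} {T : Hom Y Z} → R ⨾ (S ⨾ T) ≈ (R ⨾ S) ⨾ T
  sym-assoc = ≈.sym assoc

  pullˡ : {a : Hom W X} {b : Hom X Y} {c : Hom W Y} {r : Hom Y Z} →
          a ⨾ b ≈ c → a ⨾ (b ⨾ r) ≈ c ⨾ r
  pullˡ p = ≈.trans sym-assoc (p ⟩⨾⟨refl)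

  pullˡ₃ : {a : Hom V W} {b : Hom W X} {c : Hom X Y} {d : Hom V Y} {r : Hom Y Z} →
           a ⨾ b ⨾ c ≈ d → a ⨾ (b ⨾ (c ⨾ r)) ≈ d ⨾ r
  pullˡ₃ p = ≈.trans (refl⟩⨾⟨ sym-assoc) (pullˡ p)

  extendˡ : {a : Hom W X} {b : Hom X Y} {c : Hom W V} {d : Hom V Y} {r : Hom Y Z} →
            a ⨾ b ≈ c ⨾ d → a ⨾ (b ⨾ r) ≈ c ⨾ (d ⨾ r)
  extendˡ p = ≈.trans (pullˡ p) assoc

  cancelʳ : {a : Hom X Y} {c : Hom Y Z} {c' : Hom Z Y} → c ⨾ c' ≈ id → (a ⨾ c) ⨾ c' ≈ a
  cancelʳ q = ≈.trans assoc (≈.trans (refl⟩⨾⟨ q) identityʳ)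

  inverse-unique : {a : Hom X Y} {c : Hom Y X} {c' : Hom X Y} →
                   a ⨾ c ≈ id → c ⨾ c' ≈ id → a ≈ c'
  inverse-unique {a = a} {c} {c'} p q = begin-equality
    a              ≈⟨ identityʳ ⟨
    a ⨾ id         ≈⟨ refl⟩⨾⟨ q ⟨
    a ⨾ (c ⨾ c')   ≈⟨ sym-assoc ⟩
    (a ⨾ c) ⨾ c'   ≈⟨ p ⟩⨾⟨refl ⟩
    id ⨾ c'        ≈⟨ identityˡ ⟩
    c'             ∎

  conjugate : {a : Hom X X'} {b : Hom Y Y'} {c : Hom X Y} {c' : Hom Y X}
              {d : Hom X' Y'} {d' : Hom Y' X'} →
              c' ⨾ c ≈ id → d ⨾ d' ≈ id → a ⨾ d ≈ c ⨾ b → c' ⨾ a ≈ b ⨾ d'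
  conjugate {a = a} {b} {c} {c'} {d} {d'} c'c dd' square = begin-equality
    c' ⨾ a                ≈⟨ identityʳ ⟨
    (c' ⨾ a) ⨾ id         ≈⟨ refl⟩⨾⟨ dd' ⟨
    (c' ⨾ a) ⨾ (d ⨾ d')   ≈⟨ ≈.trans assoc (refl⟩⨾⟨ sym-assoc) ⟩
    c' ⨾ ((a ⨾ d) ⨾ d')   ≈⟨ refl⟩⨾⟨ (square ⟩⨾⟨refl) ⟩
    c' ⨾ ((c ⨾ b) ⨾ d')   ≈⟨ ≈.trans (refl⟩⨾⟨ assoc) sym-assoc ⟩
    (c' ⨾ c) ⨾ (b ⨾ d')   ≈⟨ c'c ⟩⨾⟨refl ⟩
    id ⨾ (b ⨾ d')         ≈⟨ identityˡ ⟩
    b ⨾ d'                ∎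

  serialize₁₂ : {R : Hom X Y} {S : Hom X' Y'} → R ⊗₁ S ≈ (R ⊗₁ id) ⨾ (id ⊗₁ S)
  serialize₁₂ = ≈.trans (≈.sym identityʳ ⟩⊗⟨ ≈.sym identityˡ) ⊗-⨾

  serialize₂₁ : {R : Hom X Y} {S : Hom X' Y'} → R ⊗₁ S ≈ (id ⊗₁ S) ⨾ (R ⊗₁ id)
  serialize₂₁ = ≈.trans (≈.sym identityˡ ⟩⊗⟨ ≈.sym identityʳ) ⊗-⨾

  ⊗-⨾ˡ : {R : Hom X Y} {S : Hom Y Z} → (R ⨾ S) ⊗₁ id {W} ≈ (R ⊗₁ id) ⨾ (S ⊗₁ id)
  ⊗-⨾ˡ = ≈.trans (≈.refl ⟩⊗⟨ ≈.sym identityˡ) ⊗-⨾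

  ⊗-⨾ʳ : {R : Hom X Y} {S : Hom Y Z} → id {W} ⊗₁ (R ⨾ S) ≈ (id ⊗₁ R) ⨾ (id ⊗₁ S)
  ⊗-⨾ʳ = ≈.trans (≈.sym identityˡ ⟩⊗⟨ ≈.refl) ⊗-⨾

  coe-refl : (p : X ≡ X) → coe p ≈ id
  coe-refl p rewrite uip p refl = ≈.refl

  coe-⨾ : (p : X ≡ Y) (q : Y ≡ Z) (r : X ≡ Z) → coe p ⨾ coe q ≈ coe r
  coe-⨾ refl refl r = ≈.trans identityˡ (≈.sym (coe-refl r))

  coe-⨾₃ : ∀ {X₁ X₂ X₃} (p : X ≡ X₁) (q : X₁ ≡ X₂) (r : X₂ ≡ X₃) (t : X ≡ X₃) →
           coe p ⨾ coe q ⨾ coe r ≈ coe t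
  coe-⨾₃ p q r t = ≈.trans (refl⟩⨾⟨ coe-⨾ q r (trans q r)) (coe-⨾ p (trans q r) t)

  coe-⨾₄ : ∀ {X₁ X₂ X₃ X₄} (p : X ≡ X₁) (q : X₁ ≡ X₂) (r : X₂ ≡ X₃) (s : X₃ ≡ X₄) (t : X ≡ X₄) →
           coe p ⨾ coe q ⨾ coe r ⨾ coe s ≈ coe t
  coe-⨾₄ p q r s t = ≈.trans (refl⟩⨾⟨ refl⟩⨾⟨ coe-⨾ r s (trans r s)) (coe-⨾₃ p q (trans r s) t)

  coe-inverse : (p : X ≡ Y) (q : Y ≡ X) → coe p ⨾ coe q ≈ id
  coe-inverse p q = coe-⨾ p q refl

  coe-⊗ : (p : X ≡ Y) (q : X' ≡ Y') (r : X ⊗₀ X' ≡ Y ⊗₀ Y') → coe p ⊗₁ coe q ≈ coe r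
  coe-⊗ refl refl r = ≈.trans ⊗-id (≈.sym (coe-refl r))

  λ⇒ : Hom (I ⊗₀ X) X
  λ⇒ = coe ⊗-unitˡ₀

  λ⇐ : Hom X (I ⊗₀ X)
  λ⇐ = coe (sym ⊗-unitˡ₀)

  ρ⇒ : Hom (X ⊗₀ I) X
  ρ⇒ = coe ⊗-unitʳ₀

  ρ⇐ : Hom X (X ⊗₀ I)
  ρ⇐ = coe (sym ⊗-unitʳ₀)

  α⇒ : Hom ((X ⊗₀ Y) ⊗₀ Z) (X ⊗₀ (Y ⊗₀ Z))
  α⇒ = coe ⊗-assoc₀

  α⇐ : Hom (X ⊗₀ (Y ⊗₀ Z)) ((X ⊗₀ Y) ⊗₀ Z)
  α⇐ = coe (sym ⊗-assoc₀)

  ρ⇐-natural : {R : Hom X Y} → R ⨾ ρ⇐ ≈ ρ⇐ ⨾ (R ⊗₁ id)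
  ρ⇐-natural = ≈.sym (conjugate (coe-inverse _ _) (coe-inverse _ _) ⊗-unitʳ₁)

  α⇐-natural : {R : Hom X X'} {S : Hom Y Y'} {T : Hom Z Z'} →
               (R ⊗₁ (S ⊗₁ T)) ⨾ α⇐ ≈ α⇐ ⨾ ((R ⊗₁ S) ⊗₁ T)
  α⇐-natural = ≈.sym (conjugate (coe-inverse _ _) (coe-inverse _ _) ⊗-assoc₁)

  -- Adjunctions

  infix 4 _⊣_
  _⊣_ : Hom X Y → Hom Y X → Set e
  f ⊣ u = (id ≤ f ⨾ u) × (u ⨾ f ≤ id)

  ⊣-id : id {X} ⊣ id
  ⊣-id = proj₂ identityˡ , proj₁ identityˡ

  ⊣-⨾ : {f : Hom X Y} {u : Hom Y X} {g : Hom Y Z} {v : Hom Z Y} →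
        f ⊣ u → g ⊣ v → f ⨾ g ⊣ v ⨾ u
  ⊣-⨾ {f = f} {u} {g} {v} (unit₁ , counit₁) (unit₂ , counit₂) = unit , counit
    where
      unit : id ≤ (f ⨾ g) ⨾ (v ⨾ u)
      unit = begin
        id                  ≲⟨ unit₁ ⟩
        f ⨾ u               ≈⟨ identityʳ ⟩⨾⟨refl ⟨
        (f ⨾ id) ⨾ u        ≲⟨ ⨾-mono (⨾-mono ≤-refl unit₂) ≤-refl ⟩
        (f ⨾ (g ⨾ v)) ⨾ u   ≈⟨ ≈.trans (sym-assoc ⟩⨾⟨refl) assoc ⟩
        (f ⨾ g) ⨾ (v ⨾ u)   ∎
      counit : (v ⨾ u) ⨾ (f ⨾ g) ≤ id
      counit = begin
        (v ⨾ u) ⨾ (f ⨾ g)   ≈⟨ ≈.trans assoc (refl⟩⨾⟨ sym-assoc) ⟩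
        v ⨾ ((u ⨾ f) ⨾ g)   ≲⟨ ⨾-mono ≤-refl (⨾-mono counit₁ ≤-refl) ⟩
        v ⨾ (id ⨾ g)        ≈⟨ refl⟩⨾⟨ identityˡ ⟩
        v ⨾ g               ≲⟨ counit₂ ⟩
        id                  ∎

  ⊣-⊗ : {f : Hom X Y} {u : Hom Y X} {g : Hom X' Y'} {v : Hom Y' X'} →
        f ⊣ u → g ⊣ v → f ⊗₁ g ⊣ u ⊗₁ v
  ⊣-⊗ {f = f} {u} {g} {v} (unit₁ , counit₁) (unit₂ , counit₂) = unit , counit
    where
      unit : id ≤ (f ⊗₁ g) ⨾ (u ⊗₁ v)
      unit = begin
        id                      ≈⟨ ⊗-id ⟨
        id ⊗₁ id                ≲⟨ ⊗-mono unit₁ unit₂ ⟩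
        (f ⨾ u) ⊗₁ (g ⨾ v)      ≈⟨ ⊗-⨾ ⟩
        (f ⊗₁ g) ⨾ (u ⊗₁ v)     ∎
      counit : (u ⊗₁ v) ⨾ (f ⊗₁ g) ≤ id
      counit = begin
        (u ⊗₁ v) ⨾ (f ⊗₁ g)     ≈⟨ ⊗-⨾ ⟨
        (u ⨾ f) ⊗₁ (v ⨾ g)      ≲⟨ ⊗-mono counit₁ counit₂ ⟩
        id ⊗₁ id                ≈⟨ ⊗-id ⟩
        id                      ∎

  coe-⊣ : (p : X ≡ Y) → coe p ⊣ coe (sym p)
  coe-⊣ p = proj₂ (coe-inverse p (sym p)) , proj₁ (coe-inverse (sym p) p)

  ⊣-resp-≈ : {f f' : Hom X Y} {u u' : Hom Y X} → f ≈ f' → u ≈ u' → f ⊣ u → f' ⊣ u'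
  ⊣-resp-≈ p q (unit , counit) = ≤-trans unit (proj₁ (p ⟩⨾⟨ q)) , ≤-trans (proj₂ (q ⟩⨾⟨ p)) counit

  right-adjoint-≤ : {f : Hom X Y} {u u' : Hom Y X} → f ⊣ u → f ⊣ u' → u ≤ u'
  right-adjoint-≤ {f = f} {u} {u'} (_ , counit) (unit' , _) = begin
    u               ≈⟨ identityʳ ⟨
    u ⨾ id          ≲⟨ ⨾-mono ≤-refl unit' ⟩
    u ⨾ (f ⨾ u')    ≈⟨ sym-assoc ⟩
    (u ⨾ f) ⨾ u'    ≲⟨ ⨾-mono counit ≤-refl ⟩
    id ⨾ u'         ≈⟨ identityˡ ⟩
    u'              ∎

  right-adjoint-unique : {f : Hom X Y} {u u' : Hom Y X} → f ⊣ u → f ⊣ u' → u ≈ u'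
  right-adjoint-unique a b = right-adjoint-≤ a b , right-adjoint-≤ b a

  δ⊣δ* : δ {X} ⊣ δ*
  δ⊣δ* = δ-unit , δ-counit

  ε⊣ε* : ε {X} ⊣ ε*
  ε⊣ε* = ε-unit , ε-counit

  -- Maps and the compact closed structure

  left-adjoint⇒map : {f : Hom X Y} {u : Hom Y X} → f ⊣ u → IsMap B f
  left-adjoint⇒map {f = f} {u} (unit , counit) = comultiplicative , counital
    where
      comultiplicative : δ ⨾ (f ⊗₁ f) ≤ f ⨾ δ
      comultiplicative = begin
        δ ⨾ (f ⊗₁ f)                        ≈⟨ identityˡ ⟨
        id ⨾ (δ ⨾ (f ⊗₁ f))                 ≲⟨ ⨾-mono unit ≤-refl ⟩
        (f ⨾ u) ⨾ (δ ⨾ (f ⊗₁ f))            ≈⟨ ≈.trans assoc (refl⟩⨾⟨ sym-assoc) ⟩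
        f ⨾ ((u ⨾ δ) ⨾ (f ⊗₁ f))            ≲⟨ ⨾-mono ≤-refl (⨾-mono δ-lax ≤-refl) ⟩
        f ⨾ ((δ ⨾ (u ⊗₁ u)) ⨾ (f ⊗₁ f))     ≈⟨ refl⟩⨾⟨ ≈.trans assoc (refl⟩⨾⟨ ≈.sym ⊗-⨾) ⟩
        f ⨾ (δ ⨾ ((u ⨾ f) ⊗₁ (u ⨾ f)))      ≲⟨ ⨾-mono ≤-refl (⨾-mono ≤-refl (⊗-mono counit counit)) ⟩
        f ⨾ (δ ⨾ (id ⊗₁ id))                ≈⟨ refl⟩⨾⟨ ≈.trans (refl⟩⨾⟨ ⊗-id) identityʳ ⟩
        f ⨾ δ                               ∎
      counital : ε ≤ f ⨾ ε
      counital = begin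
        ε               ≈⟨ identityˡ ⟨
        id ⨾ ε          ≲⟨ ⨾-mono unit ≤-refl ⟩
        (f ⨾ u) ⨾ ε     ≈⟨ assoc ⟩
        f ⨾ (u ⨾ ε)     ≲⟨ ⨾-mono ≤-refl ε-lax ⟩
        f ⨾ ε           ∎

  map⇒δ-natural : {f : Hom X Y} → IsMap B f → δ ⨾ (f ⊗₁ f) ≈ f ⨾ δ
  map⇒δ-natural (comultiplicative , _) = comultiplicative , δ-lax

  map⇒ε-natural : {f : Hom X Y} → IsMap B f → f ⨾ ε ≈ ε
  map⇒ε-natural (_ , counital) = ε-lax , counital

  cup : Hom I (X ⊗₀ X)
  cup = ε* ⨾ δ

  cap : Hom (X ⊗₀ X) I
  cap = δ* ⨾ ε

  cupʳ : (Y X : Obj) → Hom Y ((Y ⊗₀ X) ⊗₀ X)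
  cupʳ Y X = ρ⇐ ⨾ (id ⊗₁ cup) ⨾ α⇐

  capˡ : (Y X : Obj) → Hom ((Y ⊗₀ Y) ⊗₀ X) X
  capˡ Y X = (cap ⊗₁ id) ⨾ λ⇒

  op-via-cup-cap : {R : Hom X Y} → op B R ≈ cupʳ Y X ⨾ ((id ⊗₁ R) ⊗₁ id) ⨾ capˡ Y X
  op-via-cup-cap = ≈.trans (refl⟩⨾⟨ sym-assoc) sym-assoc

  δ*-unitʳ : ρ⇐ ⨾ (id ⊗₁ ε*) ⨾ δ* ≈ id {X}
  δ*-unitʳ = right-adjoint-unique
    (⊣-resp-≈ δ-unitʳ assoc (⊣-⨾ δ⊣δ* (⊣-⨾ (⊣-⊗ ⊣-id ε⊣ε*) (coe-⊣ _)))) ⊣-id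

  -- By Frobenius the zigzag collapses to the mate of δ-unitʳ followed by δ-unitˡ.
  snake : cupʳ X X ⨾ capˡ X X ≈ id
  snake = begin-equality
    (ρ⇐ ⨾ (id ⊗₁ cup) ⨾ α⇐) ⨾ (cap ⊗₁ id) ⨾ λ⇒
      ≈⟨ ≈.trans assoc (refl⟩⨾⟨ assoc) ⟩
    ρ⇐ ⨾ (id ⊗₁ cup) ⨾ α⇐ ⨾ (cap ⊗₁ id) ⨾ λ⇒
      ≈⟨ refl⟩⨾⟨ (⊗-⨾ʳ ⟩⨾⟨ refl⟩⨾⟨ (⊗-⨾ˡ ⟩⨾⟨refl)) ⟩
    ρ⇐ ⨾ ((id ⊗₁ ε*) ⨾ (id ⊗₁ δ)) ⨾ α⇐ ⨾ ((δ* ⊗₁ id) ⨾ (ε ⊗₁ id)) ⨾ λ⇒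
      ≈⟨ refl⟩⨾⟨ ≈.trans assoc (refl⟩⨾⟨ refl⟩⨾⟨ refl⟩⨾⟨ assoc) ⟩
    ρ⇐ ⨾ (id ⊗₁ ε*) ⨾ (id ⊗₁ δ) ⨾ α⇐ ⨾ (δ* ⊗₁ id) ⨾ (ε ⊗₁ id) ⨾ λ⇒
      ≈⟨ refl⟩⨾⟨ refl⟩⨾⟨ pullˡ₃ (≈.sym frobenius) ⟩
    ρ⇐ ⨾ (id ⊗₁ ε*) ⨾ (δ* ⨾ δ) ⨾ (ε ⊗₁ id) ⨾ λ⇒
      ≈⟨ ≈.trans (refl⟩⨾⟨ refl⟩⨾⟨ assoc) (≈.trans (refl⟩⨾⟨ sym-assoc) sym-assoc) ⟩
    (ρ⇐ ⨾ (id ⊗₁ ε*) ⨾ δ*) ⨾ δ ⨾ (ε ⊗₁ id) ⨾ λ⇒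
      ≈⟨ δ*-unitʳ ⟩⨾⟨ δ-unitˡ ⟩
    id ⨾ id
      ≈⟨ identityˡ ⟩
    id ∎

  cupʳ-natural : {g : Hom X' Y} → g ⨾ cupʳ Y X ≈ cupʳ X' X ⨾ ((g ⊗₁ id) ⊗₁ id)
  cupʳ-natural {g = g} = begin-equality
    g ⨾ ρ⇐ ⨾ (id ⊗₁ cup) ⨾ α⇐               ≈⟨ extendˡ ρ⇐-natural ⟩
    ρ⇐ ⨾ (g ⊗₁ id) ⨾ (id ⊗₁ cup) ⨾ α⇐       ≈⟨ refl⟩⨾⟨ extendˡ (≈.trans (≈.sym serialize₁₂) serialize₂₁) ⟩
    ρ⇐ ⨾ (id ⊗₁ cup) ⨾ (g ⊗₁ id) ⨾ α⇐       ≈⟨ refl⟩⨾⟨ refl⟩⨾⟨ ((≈.refl ⟩⊗⟨ ⊗-id) ⟩⨾⟨refl) ⟨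
    ρ⇐ ⨾ (id ⊗₁ cup) ⨾ (g ⊗₁ (id ⊗₁ id)) ⨾ α⇐
                                             ≈⟨ refl⟩⨾⟨ refl⟩⨾⟨ α⇐-natural ⟩
    ρ⇐ ⨾ (id ⊗₁ cup) ⨾ α⇐ ⨾ ((g ⊗₁ id) ⊗₁ id)
                                             ≈⟨ ≈.trans (refl⟩⨾⟨ sym-assoc) sym-assoc ⟩
    (ρ⇐ ⨾ (id ⊗₁ cup) ⨾ α⇐) ⨾ ((g ⊗₁ id) ⊗₁ id) ∎

  capˡ-natural : {g : Hom X X'} → capˡ Y X ⨾ g ≈ ((id ⊗₁ id) ⊗₁ g) ⨾ capˡ Y X'
  capˡ-natural {g = g} = begin-equality
    ((cap ⊗₁ id) ⨾ λ⇒) ⨾ g                   ≈⟨ ≈.trans assoc (refl⟩⨾⟨ ≈.sym ⊗-unitˡ₁) ⟩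
    (cap ⊗₁ id) ⨾ (id ⊗₁ g) ⨾ λ⇒             ≈⟨ pullˡ (≈.sym serialize₁₂) ⟩
    (cap ⊗₁ g) ⨾ λ⇒                          ≈⟨ ≈.trans (serialize₂₁ ⟩⨾⟨refl) assoc ⟩
    (id ⊗₁ g) ⨾ (cap ⊗₁ id) ⨾ λ⇒             ≈⟨ (⊗-id ⟩⊗⟨ ≈.refl) ⟩⨾⟨refl ⟨
    ((id ⊗₁ id) ⊗₁ g) ⨾ (cap ⊗₁ id) ⨾ λ⇒     ∎

  δ*-lax : {f : Hom X Y} → δ* ⨾ f ≤ (f ⊗₁ f) ⨾ δ*
  δ*-lax {f = f} = begin
    δ* ⨾ f                          ≈⟨ identityʳ ⟨
    (δ* ⨾ f) ⨾ id                   ≲⟨ ⨾-mono ≤-refl δ-unit ⟩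
    (δ* ⨾ f) ⨾ (δ ⨾ δ*)             ≈⟨ ≈.trans assoc (refl⟩⨾⟨ sym-assoc) ⟩
    δ* ⨾ ((f ⨾ δ) ⨾ δ*)             ≲⟨ ⨾-mono ≤-refl (⨾-mono δ-lax ≤-refl) ⟩
    δ* ⨾ ((δ ⨾ (f ⊗₁ f)) ⨾ δ*)      ≈⟨ ≈.trans (refl⟩⨾⟨ assoc) sym-assoc ⟩
    (δ* ⨾ δ) ⨾ ((f ⊗₁ f) ⨾ δ*)      ≲⟨ ⨾-mono δ-counit ≤-refl ⟩
    id ⨾ ((f ⊗₁ f) ⨾ δ*)            ≈⟨ identityˡ ⟩
    (f ⊗₁ f) ⨾ δ*                   ∎

  ε*-lax : {f : Hom X Y} → ε* ⨾ f ≤ ε*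
  ε*-lax {f = f} = begin
    ε* ⨾ f                ≈⟨ identityʳ ⟨
    (ε* ⨾ f) ⨾ id         ≲⟨ ⨾-mono ≤-refl ε-unit ⟩
    (ε* ⨾ f) ⨾ (ε ⨾ ε*)   ≈⟨ ≈.trans assoc (refl⟩⨾⟨ sym-assoc) ⟩
    ε* ⨾ ((f ⨾ ε) ⨾ ε*)   ≲⟨ ⨾-mono ≤-refl (⨾-mono ε-lax ≤-refl) ⟩
    ε* ⨾ (ε ⨾ ε*)         ≈⟨ sym-assoc ⟩
    (ε* ⨾ ε) ⨾ ε*         ≲⟨ ⨾-mono ε-counit ≤-refl ⟩
    id ⨾ ε*               ≈⟨ identityˡ ⟩
    ε*                    ∎

  map⇒cap-lax : {f : Hom X Y} → IsMap B f → cap ≤ (f ⊗₁ f) ⨾ cap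
  map⇒cap-lax {f = f} (_ , counital) = begin
    δ* ⨾ ε                  ≲⟨ ⨾-mono ≤-refl counital ⟩
    δ* ⨾ (f ⨾ ε)            ≈⟨ sym-assoc ⟩
    (δ* ⨾ f) ⨾ ε            ≲⟨ ⨾-mono δ*-lax ≤-refl ⟩
    ((f ⊗₁ f) ⨾ δ*) ⨾ ε     ≈⟨ assoc ⟩
    (f ⊗₁ f) ⨾ δ* ⨾ ε       ∎

  map⇒cup-lax : {f : Hom X Y} → IsMap B f → cup ⨾ (f ⊗₁ f) ≤ cup
  map⇒cup-lax {f = f} (comultiplicative , _) = begin
    (ε* ⨾ δ) ⨾ (f ⊗₁ f)     ≈⟨ assoc ⟩
    ε* ⨾ (δ ⨾ (f ⊗₁ f))     ≲⟨ ⨾-mono ≤-refl comultiplicative ⟩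
    ε* ⨾ (f ⨾ δ)            ≈⟨ sym-assoc ⟩
    (ε* ⨾ f) ⨾ δ            ≲⟨ ⨾-mono ε*-lax ≤-refl ⟩
    ε* ⨾ δ                  ∎

  map-unit : {f : Hom X Y} → IsMap B f → id ≤ f ⨾ op B f
  map-unit {X = X} {Y = Y} {f = f} f-map = begin
    id
      ≈⟨ snake ⟨
    cupʳ X X ⨾ capˡ X X
      ≲⟨ ⨾-mono ≤-refl (⨾-mono (⊗-mono (map⇒cap-lax f-map) ≤-refl) ≤-refl) ⟩
    cupʳ X X ⨾ ((((f ⊗₁ f) ⨾ cap) ⊗₁ id) ⨾ λ⇒)
      ≈⟨ refl⟩⨾⟨ ≈.trans (⊗-⨾ˡ ⟩⨾⟨refl) assoc ⟩
    cupʳ X X ⨾ ((f ⊗₁ f) ⊗₁ id) ⨾ capˡ Y X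
      ≈⟨ refl⟩⨾⟨ ≈.trans ((serialize₁₂ ⟩⊗⟨ ≈.refl) ⟩⨾⟨refl) (≈.trans (⊗-⨾ˡ ⟩⨾⟨refl) assoc) ⟩
    cupʳ X X ⨾ ((f ⊗₁ id) ⊗₁ id) ⨾ ((id ⊗₁ f) ⊗₁ id) ⨾ capˡ Y X
      ≈⟨ pullˡ (≈.sym cupʳ-natural) ⟩
    (f ⨾ cupʳ Y X) ⨾ ((id ⊗₁ f) ⊗₁ id) ⨾ capˡ Y X
      ≈⟨ ≈.trans assoc (refl⟩⨾⟨ ≈.sym op-via-cup-cap) ⟩
    f ⨾ op B f ∎

  map-counit : {f : Hom X Y} → IsMap B f → op B f ⨾ f ≤ id
  map-counit {X = X} {Y = Y} {f = f} f-map = begin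
    op B f ⨾ f
      ≈⟨ op-via-cup-cap ⟩⨾⟨refl ⟩
    (cupʳ Y X ⨾ ((id ⊗₁ f) ⊗₁ id) ⨾ capˡ Y X) ⨾ f
      ≈⟨ ≈.trans assoc (refl⟩⨾⟨ ≈.trans assoc (refl⟩⨾⟨ capˡ-natural)) ⟩
    cupʳ Y X ⨾ ((id ⊗₁ f) ⊗₁ id) ⨾ ((id ⊗₁ id) ⊗₁ f) ⨾ capˡ Y Y
      ≈⟨ refl⟩⨾⟨ pullˡ (≈.trans (≈.sym ⊗-⨾) (≈.trans (refl⟩⨾⟨ ⊗-id) identityʳ ⟩⊗⟨ identityˡ)) ⟩
    cupʳ Y X ⨾ ((id ⊗₁ f) ⊗₁ f) ⨾ capˡ Y Y
      ≈⟨ ≈.trans (≈.trans assoc (refl⟩⨾⟨ assoc)) (refl⟩⨾⟨ refl⟩⨾⟨ pullˡ (≈.sym α⇐-natural)) ⟩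
    ρ⇐ ⨾ (id ⊗₁ cup) ⨾ ((id ⊗₁ (f ⊗₁ f)) ⨾ α⇐) ⨾ capˡ Y Y
      ≈⟨ refl⟩⨾⟨ ≈.trans (refl⟩⨾⟨ assoc) sym-assoc ⟩
    ρ⇐ ⨾ ((id ⊗₁ cup) ⨾ (id ⊗₁ (f ⊗₁ f))) ⨾ α⇐ ⨾ capˡ Y Y
      ≈⟨ refl⟩⨾⟨ (≈.sym ⊗-⨾ʳ ⟩⨾⟨refl) ⟩
    ρ⇐ ⨾ (id ⊗₁ (cup ⨾ (f ⊗₁ f))) ⨾ α⇐ ⨾ capˡ Y Y
      ≲⟨ ⨾-mono ≤-refl (⨾-mono (⊗-mono ≤-refl (map⇒cup-lax f-map)) ≤-refl) ⟩
    ρ⇐ ⨾ (id ⊗₁ cup) ⨾ α⇐ ⨾ capˡ Y Y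
      ≈⟨ ≈.trans (refl⟩⨾⟨ sym-assoc) sym-assoc ⟩
    cupʳ Y Y ⨾ capˡ Y Y
      ≈⟨ snake ⟩
    id ∎

  map⇒⊣op : {f : Hom X Y} → IsMap B f → f ⊣ op B f
  map⇒⊣op f-map = map-unit f-map , map-counit f-map

  op-right-adjoint : {f : Hom X Y} {u : Hom Y X} → f ⊣ u → op B f ≈ u
  op-right-adjoint f⊣u = right-adjoint-unique (map⇒⊣op (left-adjoint⇒map f⊣u)) f⊣u

  op-mono : {R S : Hom X Y} → R ≤ S → op B R ≤ op B S
  op-mono p = ⨾-mono ≤-refl (⨾-mono ≤-refl (⨾-mono ≤-refl
                (⨾-mono (⊗-mono (⊗-mono ≤-refl p) ≤-refl) ≤-refl)))

  op-cong : {R S : Hom X Y} → R ≈ S → op B R ≈ op B S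
  op-cong (p , q) = op-mono p , op-mono q

  map-id : IsMap B (id {X})
  map-id = left-adjoint⇒map ⊣-id

  map-⨾ : {f : Hom X Y} {g : Hom Y Z} → IsMap B f → IsMap B g → IsMap B (f ⨾ g)
  map-⨾ f-map g-map = left-adjoint⇒map (⊣-⨾ (map⇒⊣op f-map) (map⇒⊣op g-map))

  map-⊗ : {f : Hom X Y} {g : Hom X' Y'} → IsMap B f → IsMap B g → IsMap B (f ⊗₁ g)
  map-⊗ f-map g-map = left-adjoint⇒map (⊣-⊗ (map⇒⊣op f-map) (map⇒⊣op g-map))

  map-coe : (p : X ≡ Y) → IsMap B (coe p)
  map-coe p = left-adjoint⇒map (coe-⊣ p)

  map-δ : IsMap B (δ {X})
  map-δ = left-adjoint⇒map δ⊣δ*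

  map-ε : IsMap B (ε {X})
  map-ε = left-adjoint⇒map ε⊣ε*

  op-id : op B (id {X}) ≈ id
  op-id = op-right-adjoint ⊣-id

  op-⨾ : {f : Hom X Y} {g : Hom Y Z} → IsMap B f → IsMap B g → op B (f ⨾ g) ≈ op B g ⨾ op B f
  op-⨾ f-map g-map = op-right-adjoint (⊣-⨾ (map⇒⊣op f-map) (map⇒⊣op g-map))

  op-⊗ : {f : Hom X Y} {g : Hom X' Y'} → IsMap B f → IsMap B g → op B (f ⊗₁ g) ≈ op B f ⊗₁ op B g
  op-⊗ f-map g-map = op-right-adjoint (⊣-⊗ (map⇒⊣op f-map) (map⇒⊣op g-map))

  -- The assignment on spans

  F-mono : (s t : Span B X Y) → IsSpanOfMaps B s → IsSpanOfMaps B t → _≤ₛ_ B s t → F B s ≤ F B t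
  F-mono (span _ ls rs) (span _ lt rt) _ (lt-map , _) (α , α-map , α-left , α-right) = begin
    op B ls ⨾ rs                     ≈⟨ op-cong α-left ⟩⨾⟨ α-right ⟨
    op B (α ⨾ lt) ⨾ (α ⨾ rt)         ≈⟨ op-⨾ α-map lt-map ⟩⨾⟨refl ⟩
    (op B lt ⨾ op B α) ⨾ (α ⨾ rt)    ≈⟨ ≈.trans assoc (refl⟩⨾⟨ sym-assoc) ⟩
    op B lt ⨾ ((op B α ⨾ α) ⨾ rt)    ≲⟨ ⨾-mono ≤-refl (⨾-mono (map-counit α-map) ≤-refl) ⟩
    op B lt ⨾ (id ⨾ rt)              ≈⟨ refl⟩⨾⟨ identityˡ ⟩
    op B lt ⨾ rt                     ∎

  F-idˡ : {R : Hom X Y} → F B (span X id R) ≈ R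
  F-idˡ = ≈.trans (op-id ⟩⨾⟨refl) identityˡ

  F-right-adjoint : {f : Hom X Y} {u : Hom Y X} → f ⊣ u → F B (span X f id) ≈ u
  F-right-adjoint f⊣u = ≈.trans identityʳ (op-right-adjoint f⊣u)

  F-⊗ : (s : Span B X Y) (t : Span B X' Y') → IsSpanOfMaps B s → IsSpanOfMaps B t →
        F B (_⊗ₛ_ B s t) ≈ F B s ⊗₁ F B t
  F-⊗ _ _ (ls-map , _) (lt-map , _) = ≈.trans (op-⊗ ls-map lt-map ⟩⨾⟨refl) (≈.sym ⊗-⨾)

  -- Products in Map(B)

  π₁ : Hom (X ⊗₀ Y) X
  π₁ = (id ⊗₁ ε) ⨾ ρ⇒

  π₂ : Hom (X ⊗₀ Y) Y
  π₂ = (ε ⊗₁ id) ⨾ λ⇒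

  ⟨_,_⟩ : Hom Z X → Hom Z Y → Hom Z (X ⊗₀ Y)
  ⟨ f , g ⟩ = δ ⨾ (f ⊗₁ g)

  map-π₁ : IsMap B (π₁ {X} {Y})
  map-π₁ = map-⨾ (map-⊗ map-id map-ε) (map-coe _)

  map-π₂ : IsMap B (π₂ {X} {Y})
  map-π₂ = map-⨾ (map-⊗ map-ε map-id) (map-coe _)

  map-pair : {f : Hom Z X} {g : Hom Z Y} → IsMap B f → IsMap B g → IsMap B ⟨ f , g ⟩
  map-pair f-map g-map = map-⨾ map-δ (map-⊗ f-map g-map)

  δ-unitʳ⇐ : δ ⨾ (id ⊗₁ ε) ≈ ρ⇐ {X}
  δ-unitʳ⇐ = inverse-unique (≈.trans assoc δ-unitʳ) (coe-inverse _ _)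

  δ-unitˡ⇐ : δ ⨾ (ε ⊗₁ id) ≈ λ⇐ {X}
  δ-unitˡ⇐ = inverse-unique (≈.trans assoc δ-unitˡ) (coe-inverse _ _)

  π₂-β : {f : Hom Z X} {g : Hom Z Y} → IsMap B f → ⟨ f , g ⟩ ⨾ π₂ ≈ g
  π₂-β {f = f} {g} f-map = begin-equality
    (δ ⨾ (f ⊗₁ g)) ⨾ (ε ⊗₁ id) ⨾ λ⇒   ≈⟨ ≈.trans assoc (refl⟩⨾⟨ pullˡ (≈.sym ⊗-⨾)) ⟩
    δ ⨾ ((f ⨾ ε) ⊗₁ (g ⨾ id)) ⨾ λ⇒     ≈⟨ refl⟩⨾⟨ ((map⇒ε-natural f-map ⟩⊗⟨ identityʳ) ⟩⨾⟨refl) ⟩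
    δ ⨾ (ε ⊗₁ g) ⨾ λ⇒                  ≈⟨ refl⟩⨾⟨ ≈.trans (serialize₁₂ ⟩⨾⟨refl) (≈.trans assoc (refl⟩⨾⟨ ⊗-unitˡ₁)) ⟩
    δ ⨾ (ε ⊗₁ id) ⨾ λ⇒ ⨾ g             ≈⟨ pullˡ₃ δ-unitˡ ⟩
    id ⨾ g                             ≈⟨ identityˡ ⟩
    g                                  ∎

  pair-natural : {u : Hom W Z} {f : Hom Z X} {g : Hom Z Y} → IsMap B u →
                 u ⨾ ⟨ f , g ⟩ ≈ ⟨ u ⨾ f , u ⨾ g ⟩
  pair-natural {u = u} {f} {g} u-map = begin-equality
    u ⨾ δ ⨾ (f ⊗₁ g)               ≈⟨ pullˡ (≈.sym (map⇒δ-natural u-map)) ⟩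
    (δ ⨾ (u ⊗₁ u)) ⨾ (f ⊗₁ g)      ≈⟨ ≈.trans assoc (refl⟩⨾⟨ ≈.sym ⊗-⨾) ⟩
    δ ⨾ ((u ⨾ f) ⊗₁ (u ⨾ g))       ∎

  pair-cong : {f f' : Hom Z X} {g g' : Hom Z Y} → f ≈ f' → g ≈ g' → ⟨ f , g ⟩ ≈ ⟨ f' , g' ⟩
  pair-cong p q = refl⟩⨾⟨ (p ⟩⊗⟨ q)

  σ-ε : σ {X} {Y} ⨾ ε ≈ ε
  σ-ε = ε-lax , (begin
    ε                 ≈⟨ identityˡ ⟨
    id ⨾ ε            ≈⟨ σ-involutive ⟩⨾⟨refl ⟨
    (σ ⨾ σ) ⨾ ε       ≈⟨ assoc ⟩
    σ ⨾ (σ ⨾ ε)       ≲⟨ ⨾-mono ≤-refl ε-lax ⟩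
    σ ⨾ ε             ∎)

  σ-ε⊗ε : σ {X} {Y} ⨾ (ε ⊗₁ ε) ≈ ε ⊗₁ ε
  σ-ε⊗ε = begin-equality
    σ ⨾ (ε ⊗₁ ε)                 ≈⟨ refl⟩⨾⟨ cancelʳ (coe-inverse _ _) ⟨
    σ ⨾ ((ε ⊗₁ ε) ⨾ λ⇒) ⨾ λ⇐     ≈⟨ refl⟩⨾⟨ (ε-⊗ ⟩⨾⟨refl) ⟨
    σ ⨾ ε ⨾ λ⇐                   ≈⟨ pullˡ σ-ε ⟩
    ε ⨾ λ⇐                       ≈⟨ ε-⊗ ⟩⨾⟨refl ⟩
    ((ε ⊗₁ ε) ⨾ λ⇒) ⨾ λ⇐         ≈⟨ cancelʳ (coe-inverse _ _) ⟩
    ε ⊗₁ ε                       ∎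

  -- The two reassociations occurring in the axiom δ-⊗.
  regroup : (A B C D : Obj) → (A ⊗₀ B) ⊗₀ (C ⊗₀ D) ≡ A ⊗₀ ((B ⊗₀ C) ⊗₀ D)
  regroup A B C D = trans ⊗-assoc₀ (cong (A ⊗₀_) (sym ⊗-assoc₀))

  ungroup : (A B C D : Obj) → A ⊗₀ ((B ⊗₀ C) ⊗₀ D) ≡ (A ⊗₀ B) ⊗₀ (C ⊗₀ D)
  ungroup A B C D = trans (cong (A ⊗₀_) ⊗-assoc₀) (sym ⊗-assoc₀)

  module _ {A₁ A₂ B₁ B₂ C₁ C₂ D₁ D₂ : Obj}
           {a : Hom A₁ A₂} {b : Hom B₁ B₂} {c : Hom C₁ C₂} {d : Hom D₁ D₂} where

    regroup-natural : ((a ⊗₁ b) ⊗₁ (c ⊗₁ d)) ⨾ coe (regroup A₂ B₂ C₂ D₂) ≈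
                      coe (regroup A₁ B₁ C₁ D₁) ⨾ (a ⊗₁ ((b ⊗₁ c) ⊗₁ d))
    regroup-natural = begin-equality
      ((a ⊗₁ b) ⊗₁ (c ⊗₁ d)) ⨾ coe (regroup A₂ B₂ C₂ D₂)
        ≈⟨ refl⟩⨾⟨ regroup-via-α ⟨
      ((a ⊗₁ b) ⊗₁ (c ⊗₁ d)) ⨾ (α⇒ ⨾ (id ⊗₁ α⇐))
        ≈⟨ ≈.trans sym-assoc (≈.trans (⊗-assoc₁ ⟩⨾⟨refl) assoc) ⟩
      α⇒ ⨾ ((a ⊗₁ (b ⊗₁ (c ⊗₁ d))) ⨾ (id ⊗₁ α⇐))
        ≈⟨ refl⟩⨾⟨ ≈.trans (≈.sym ⊗-⨾) (identityʳ ⟩⊗⟨ α⇐-natural) ⟩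
      α⇒ ⨾ (a ⊗₁ (α⇐ ⨾ ((b ⊗₁ c) ⊗₁ d)))
        ≈⟨ refl⟩⨾⟨ ≈.trans (≈.sym identityˡ ⟩⊗⟨ ≈.refl) ⊗-⨾ ⟩
      α⇒ ⨾ ((id ⊗₁ α⇐) ⨾ (a ⊗₁ ((b ⊗₁ c) ⊗₁ d)))
        ≈⟨ ≈.trans sym-assoc (regroup-via-α ⟩⨾⟨refl) ⟩
      coe (regroup A₁ B₁ C₁ D₁) ⨾ (a ⊗₁ ((b ⊗₁ c) ⊗₁ d)) ∎
      where
        regroup-via-α : ∀ {A B C D} → α⇒ ⨾ (id ⊗₁ α⇐) ≈ coe (regroup A B C D)
        regroup-via-α {A} {B} {C} {D} = ≈.trans
          (refl⟩⨾⟨ coe-⊗ refl (sym ⊗-assoc₀) (cong (A ⊗₀_) (sym ⊗-assoc₀)))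
          (coe-⨾ _ _ (regroup A B C D))

    ungroup-natural : coe (ungroup A₁ B₁ C₁ D₁) ⨾ ((a ⊗₁ b) ⊗₁ (c ⊗₁ d)) ≈
                      (a ⊗₁ ((b ⊗₁ c) ⊗₁ d)) ⨾ coe (ungroup A₂ B₂ C₂ D₂)
    ungroup-natural = begin-equality
      coe (ungroup A₁ B₁ C₁ D₁) ⨾ ((a ⊗₁ b) ⊗₁ (c ⊗₁ d))
        ≈⟨ ungroup-via-α ⟩⨾⟨refl ⟨
      ((id ⊗₁ α⇒) ⨾ α⇐) ⨾ ((a ⊗₁ b) ⊗₁ (c ⊗₁ d))
        ≈⟨ ≈.trans assoc (refl⟩⨾⟨ ≈.sym α⇐-natural) ⟩
      (id ⊗₁ α⇒) ⨾ ((a ⊗₁ (b ⊗₁ (c ⊗₁ d))) ⨾ α⇐)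
        ≈⟨ ≈.trans sym-assoc (≈.trans (≈.sym ⊗-⨾) (identityˡ ⟩⊗⟨ ≈.sym ⊗-assoc₁) ⟩⨾⟨refl) ⟩
      (a ⊗₁ (((b ⊗₁ c) ⊗₁ d) ⨾ α⇒)) ⨾ α⇐
        ≈⟨ ≈.trans ((≈.trans (≈.sym identityʳ ⟩⊗⟨ ≈.refl) ⊗-⨾) ⟩⨾⟨refl) assoc ⟩
      (a ⊗₁ ((b ⊗₁ c) ⊗₁ d)) ⨾ ((id ⊗₁ α⇒) ⨾ α⇐)
        ≈⟨ refl⟩⨾⟨ ungroup-via-α ⟩
      (a ⊗₁ ((b ⊗₁ c) ⊗₁ d)) ⨾ coe (ungroup A₂ B₂ C₂ D₂) ∎
      where
        ungroup-via-α : ∀ {A B C D} → (id ⊗₁ α⇒) ⨾ α⇐ ≈ coe (ungroup A B C D)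
        ungroup-via-α {A} {B} {C} {D} = ≈.trans
          (coe-⊗ refl ⊗-assoc₀ (cong (A ⊗₀_) ⊗-assoc₀) ⟩⨾⟨refl)
          (coe-⨾ _ _ (ungroup A B C D))

  δ-π₁⊗π₂ : δ {X ⊗₀ Y} ⨾ (π₁ ⊗₁ π₂) ≈ id
  δ-π₁⊗π₂ {X} {Y} = begin-equality
    δ ⨾ (π₁ ⊗₁ π₂)
      ≈⟨ δ-⊗ ⟩⨾⟨ ⊗-⨾ ⟩
    ((δ ⊗₁ δ) ⨾ coe (regroup X X Y Y) ⨾ (id ⊗₁ (σ ⊗₁ id)) ⨾ coe (ungroup X Y X Y)) ⨾
      (((id ⊗₁ ε) ⊗₁ (ε ⊗₁ id)) ⨾ (ρ⇒ ⊗₁ λ⇒))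
      ≈⟨ ≈.trans assoc (refl⟩⨾⟨ ≈.trans assoc (refl⟩⨾⟨ ≈.trans assoc (refl⟩⨾⟨ extendˡ ungroup-natural))) ⟩
    (δ ⊗₁ δ) ⨾ coe (regroup X X Y Y) ⨾ (id ⊗₁ (σ ⊗₁ id)) ⨾ (id ⊗₁ ((ε ⊗₁ ε) ⊗₁ id)) ⨾
      coe (ungroup X I I Y) ⨾ (ρ⇒ ⊗₁ λ⇒)
      ≈⟨ refl⟩⨾⟨ refl⟩⨾⟨ pullˡ (≈.trans (≈.sym ⊗-⨾) (identityˡ ⟩⊗⟨ ≈.trans (≈.sym ⊗-⨾) (σ-ε⊗ε ⟩⊗⟨ identityˡ))) ⟩
    (δ ⊗₁ δ) ⨾ coe (regroup X X Y Y) ⨾ (id ⊗₁ ((ε ⊗₁ ε) ⊗₁ id)) ⨾ coe (ungroup X I I Y) ⨾ (ρ⇒ ⊗₁ λ⇒)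
      ≈⟨ refl⟩⨾⟨ extendˡ regroup-natural ⟨
    (δ ⊗₁ δ) ⨾ ((id ⊗₁ ε) ⊗₁ (ε ⊗₁ id)) ⨾ coe (regroup X I I Y) ⨾ coe (ungroup X I I Y) ⨾ (ρ⇒ ⊗₁ λ⇒)
      ≈⟨ pullˡ (≈.trans (≈.sym ⊗-⨾) (δ-unitʳ⇐ ⟩⊗⟨ δ-unitˡ⇐)) ⟩
    (ρ⇐ ⊗₁ λ⇐) ⨾ coe (regroup X I I Y) ⨾ coe (ungroup X I I Y) ⨾ (ρ⇒ ⊗₁ λ⇒)
      ≈⟨ coe-⊗ (sym ⊗-unitʳ₀) (sym ⊗-unitˡ₀) unitors⁻¹ ⟩⨾⟨ refl⟩⨾⟨ refl⟩⨾⟨ coe-⊗ ⊗-unitʳ₀ ⊗-unitˡ₀ unitors ⟩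
    coe unitors⁻¹ ⨾ coe (regroup X I I Y) ⨾ coe (ungroup X I I Y) ⨾ coe unitors
      ≈⟨ coe-⨾₄ unitors⁻¹ (regroup X I I Y) (ungroup X I I Y) unitors refl ⟩
    id ∎
    where
      unitors : (X ⊗₀ I) ⊗₀ (I ⊗₀ Y) ≡ X ⊗₀ Y
      unitors = cong₂ _⊗₀_ ⊗-unitʳ₀ ⊗-unitˡ₀
      unitors⁻¹ : X ⊗₀ Y ≡ (X ⊗₀ I) ⊗₀ (I ⊗₀ Y)
      unitors⁻¹ = sym unitors

  pair-η : {h : Hom Z (X ⊗₀ Y)} → IsMap B h → ⟨ h ⨾ π₁ , h ⨾ π₂ ⟩ ≈ h
  pair-η {h = h} h-map = begin-equality
    δ ⨾ ((h ⨾ π₁) ⊗₁ (h ⨾ π₂))    ≈⟨ refl⟩⨾⟨ ⊗-⨾ ⟩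
    δ ⨾ ((h ⊗₁ h) ⨾ (π₁ ⊗₁ π₂))   ≈⟨ pullˡ (map⇒δ-natural h-map) ⟩
    (h ⨾ δ) ⨾ (π₁ ⊗₁ π₂)          ≈⟨ ≈.trans assoc (refl⟩⨾⟨ δ-π₁⊗π₂) ⟩
    h ⨾ id                        ≈⟨ identityʳ ⟩
    h                             ∎

  π₁-natural : {m : Hom Z X} → π₁ {Z} {Y} ⨾ m ≈ (m ⊗₁ id) ⨾ π₁
  π₁-natural = ≈.trans assoc (≈.trans (refl⟩⨾⟨ ≈.sym ⊗-unitʳ₁)
                 (extendˡ (≈.trans (≈.sym serialize₂₁) serialize₁₂)))

  map⊗id-π₂ : {m : Hom Z X} → IsMap B m → (m ⊗₁ id {Y}) ⨾ π₂ ≈ π₂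
  map⊗id-π₂ m-map = pullˡ (≈.trans (≈.sym ⊗-⨾) (map⇒ε-natural m-map ⟩⊗⟨ identityˡ))

  -- Bending morphisms X ⊗ Y → I into X → Y

  dup₂ : Hom (X ⊗₀ Y) ((X ⊗₀ Y) ⊗₀ Y)
  dup₂ = (id ⊗₁ δ) ⨾ α⇐

  map-dup₂ : IsMap B (dup₂ {X} {Y})
  map-dup₂ = map-⨾ (map-⊗ map-id map-δ) (map-coe _)

  dup₂-π₁ : dup₂ {X} {Y} ⨾ π₁ ≈ id
  dup₂-π₁ {X} {Y} = begin-equality
    ((id ⊗₁ δ) ⨾ α⇐) ⨾ (id ⊗₁ ε) ⨾ ρ⇒
      ≈⟨ assoc ⟩
    (id ⊗₁ δ) ⨾ α⇐ ⨾ (id ⊗₁ ε) ⨾ ρ⇒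
      ≈⟨ refl⟩⨾⟨ refl⟩⨾⟨ ((⊗-id ⟩⊗⟨ ≈.refl) ⟩⨾⟨refl) ⟨
    (id ⊗₁ δ) ⨾ α⇐ ⨾ ((id ⊗₁ id) ⊗₁ ε) ⨾ ρ⇒
      ≈⟨ refl⟩⨾⟨ extendˡ (≈.sym α⇐-natural) ⟩
    (id ⊗₁ δ) ⨾ (id ⊗₁ (id ⊗₁ ε)) ⨾ α⇐ ⨾ ρ⇒
      ≈⟨ refl⟩⨾⟨ refl⟩⨾⟨ ≈.trans (coe-⨾ _ _ X⊗ρ) (≈.sym (coe-⊗ refl ⊗-unitʳ₀ X⊗ρ)) ⟩
    (id ⊗₁ δ) ⨾ (id ⊗₁ (id ⊗₁ ε)) ⨾ (id ⊗₁ ρ⇒)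
      ≈⟨ ≈.trans (refl⟩⨾⟨ ≈.sym ⊗-⨾ʳ) (≈.sym ⊗-⨾ʳ) ⟩
    id ⊗₁ (δ ⨾ (id ⊗₁ ε) ⨾ ρ⇒)
      ≈⟨ ≈.refl ⟩⊗⟨ δ-unitʳ ⟩
    id ⊗₁ id
      ≈⟨ ⊗-id ⟩
    id ∎
    where
      X⊗ρ : X ⊗₀ (Y ⊗₀ I) ≡ X ⊗₀ Y
      X⊗ρ = cong (X ⊗₀_) ⊗-unitʳ₀

  dup₂-π₂ : dup₂ {X} {Y} ⨾ π₂ ≈ π₂
  dup₂-π₂ {X} {Y} = begin-equality
    ((id ⊗₁ δ) ⨾ α⇐) ⨾ (ε ⊗₁ id) ⨾ λ⇒
      ≈⟨ assoc ⟩
    (id ⊗₁ δ) ⨾ α⇐ ⨾ (ε ⊗₁ id) ⨾ λ⇒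
      ≈⟨ refl⟩⨾⟨ refl⟩⨾⟨ ((ε-⊗ ⟩⊗⟨ ≈.refl) ⟩⨾⟨refl) ⟩
    (id ⊗₁ δ) ⨾ α⇐ ⨾ (((ε ⊗₁ ε) ⨾ λ⇒) ⊗₁ id) ⨾ λ⇒
      ≈⟨ refl⟩⨾⟨ refl⟩⨾⟨ ≈.trans (⊗-⨾ˡ ⟩⨾⟨refl) assoc ⟩
    (id ⊗₁ δ) ⨾ α⇐ ⨾ ((ε ⊗₁ ε) ⊗₁ id) ⨾ (λ⇒ ⊗₁ id) ⨾ λ⇒
      ≈⟨ refl⟩⨾⟨ extendˡ (≈.sym α⇐-natural) ⟩
    (id ⊗₁ δ) ⨾ (ε ⊗₁ (ε ⊗₁ id)) ⨾ α⇐ ⨾ (λ⇒ ⊗₁ id) ⨾ λ⇒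
      ≈⟨ pullˡ (≈.trans (≈.sym ⊗-⨾) (identityˡ ⟩⊗⟨ δ-unitˡ⇐)) ⟩
    (ε ⊗₁ λ⇐) ⨾ α⇐ ⨾ (λ⇒ ⊗₁ id) ⨾ λ⇒
      ≈⟨ ≈.trans (serialize₁₂ ⟩⨾⟨refl) assoc ⟩
    (ε ⊗₁ id) ⨾ (id ⊗₁ λ⇐) ⨾ α⇐ ⨾ (λ⇒ ⊗₁ id) ⨾ λ⇒
      ≈⟨ refl⟩⨾⟨ ≈.trans
           (coe-⊗ refl (sym ⊗-unitˡ₀) (cong (I ⊗₀_) (sym ⊗-unitˡ₀)) ⟩⨾⟨ refl⟩⨾⟨
            (coe-⊗ ⊗-unitˡ₀ refl (cong (_⊗₀ Y) ⊗-unitˡ₀) ⟩⨾⟨refl))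
           (coe-⨾₄ _ _ _ _ _) ⟩
    (ε ⊗₁ id) ⨾ λ⇒ ∎

  dup₂-pair : ⟨ id , π₂ ⟩ ≈ dup₂ {X} {Y}
  dup₂-pair = ≈.trans (pair-cong (≈.sym dup₂-π₁) (≈.sym dup₂-π₂)) (pair-η map-dup₂)

  bend : Hom (X ⊗₀ Y) I → Hom X Y
  bend S = ρ⇐ ⨾ (id ⊗₁ cup) ⨾ α⇐ ⨾ (S ⊗₁ id) ⨾ λ⇒

  bend-cong : {S S' : Hom (X ⊗₀ Y) I} → S ≈ S' → bend S ≈ bend S'
  bend-cong p = refl⟩⨾⟨ refl⟩⨾⟨ refl⟩⨾⟨ ((p ⟩⊗⟨ ≈.refl) ⟩⨾⟨refl)

  bend-name : {R : Hom X Y} → bend ((R ⊗₁ id) ⨾ cap) ≈ R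
  bend-name {X} {Y} {R} = begin-equality
    ρ⇐ ⨾ (id ⊗₁ cup) ⨾ α⇐ ⨾ (((R ⊗₁ id) ⨾ cap) ⊗₁ id) ⨾ λ⇒
      ≈⟨ refl⟩⨾⟨ refl⟩⨾⟨ refl⟩⨾⟨ ≈.trans (⊗-⨾ˡ ⟩⨾⟨refl) assoc ⟩
    ρ⇐ ⨾ (id ⊗₁ cup) ⨾ α⇐ ⨾ ((R ⊗₁ id) ⊗₁ id) ⨾ capˡ Y Y
      ≈⟨ ≈.trans (refl⟩⨾⟨ pullˡ ≈.refl) (pullˡ ≈.refl) ⟩
    cupʳ X Y ⨾ ((R ⊗₁ id) ⊗₁ id) ⨾ capˡ Y Y
      ≈⟨ pullˡ (≈.sym cupʳ-natural) ⟩
    (R ⨾ cupʳ Y Y) ⨾ capˡ Y Y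
      ≈⟨ ≈.trans assoc (≈.trans (refl⟩⨾⟨ snake) identityʳ) ⟩
    R ∎

  op-π₁ : op B (π₁ {X} {Y}) ≈ ρ⇐ ⨾ (id ⊗₁ ε*)
  op-π₁ = op-right-adjoint (⊣-⨾ (⊣-⊗ ⊣-id ε⊣ε*) (coe-⊣ _))

  bend-op-ε : {m : Hom Z (X ⊗₀ Y)} → bend (op B m ⨾ ε) ≈ op B π₁ ⨾ dup₂ ⨾ (op B m ⊗₁ id) ⨾ π₂
  bend-op-ε {m = m} = begin-equality
    ρ⇐ ⨾ (id ⊗₁ (ε* ⨾ δ)) ⨾ α⇐ ⨾ ((op B m ⨾ ε) ⊗₁ id) ⨾ λ⇒
      ≈⟨ refl⟩⨾⟨ (⊗-⨾ʳ ⟩⨾⟨ refl⟩⨾⟨ (⊗-⨾ˡ ⟩⨾⟨refl)) ⟩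
    ρ⇐ ⨾ ((id ⊗₁ ε*) ⨾ (id ⊗₁ δ)) ⨾ α⇐ ⨾ ((op B m ⊗₁ id) ⨾ (ε ⊗₁ id)) ⨾ λ⇒
      ≈⟨ refl⟩⨾⟨ ≈.trans assoc (refl⟩⨾⟨ refl⟩⨾⟨ refl⟩⨾⟨ assoc) ⟩
    ρ⇐ ⨾ (id ⊗₁ ε*) ⨾ (id ⊗₁ δ) ⨾ α⇐ ⨾ (op B m ⊗₁ id) ⨾ (ε ⊗₁ id) ⨾ λ⇒
      ≈⟨ ≈.trans sym-assoc (refl⟩⨾⟨ sym-assoc) ⟩
    (ρ⇐ ⨾ (id ⊗₁ ε*)) ⨾ ((id ⊗₁ δ) ⨾ α⇐) ⨾ (op B m ⊗₁ id) ⨾ π₂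
      ≈⟨ op-π₁ ⟩⨾⟨refl ⟨
    op B π₁ ⨾ dup₂ ⨾ (op B m ⊗₁ id) ⨾ π₂ ∎

  dup₂-square : {m : Hom Z (X ⊗₀ Y)} → IsMap B m →
                IsWeakPullback B m ⟨ id , m ⨾ π₂ ⟩ dup₂ (m ⊗₁ id)
  dup₂-square {Z = Z} {X} {Y} {m} m-map = commutes , universal
    where
      commutes : m ⨾ dup₂ ≈ ⟨ id , m ⨾ π₂ ⟩ ⨾ (m ⊗₁ id)
      commutes = begin-equality
        m ⨾ dup₂                              ≈⟨ refl⟩⨾⟨ dup₂-pair ⟨
        m ⨾ ⟨ id , π₂ ⟩                       ≈⟨ pair-natural m-map ⟩
        ⟨ m ⨾ id , m ⨾ π₂ ⟩                   ≈⟨ pair-cong (≈.trans identityʳ (≈.sym identityˡ)) (≈.sym identityʳ) ⟩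
        δ ⨾ ((id ⨾ m) ⊗₁ ((m ⨾ π₂) ⨾ id))     ≈⟨ ≈.trans (refl⟩⨾⟨ ⊗-⨾) sym-assoc ⟩
        ⟨ id , m ⨾ π₂ ⟩ ⨾ (m ⊗₁ id)           ∎

      universal : ∀ {A} (f : Hom A (X ⊗₀ Y)) (g : Hom A (Z ⊗₀ Y)) → IsMap B f → IsMap B g →
                  f ⨾ dup₂ ≈ g ⨾ (m ⊗₁ id) →
                  Σ (Hom A Z) λ u → IsMap B u × (u ⨾ m ≈ f) × (u ⨾ ⟨ id , m ⨾ π₂ ⟩ ≈ g)
      universal f g _ g-map square = g ⨾ π₁ , map-⨾ g-map map-π₁ , factors-m , factors-pair
        where
          factors-m : (g ⨾ π₁) ⨾ m ≈ f
          factors-m = begin-equality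
            (g ⨾ π₁) ⨾ m            ≈⟨ ≈.trans assoc (refl⟩⨾⟨ π₁-natural) ⟩
            g ⨾ ((m ⊗₁ id) ⨾ π₁)    ≈⟨ ≈.trans sym-assoc (≈.sym square ⟩⨾⟨refl) ⟩
            (f ⨾ dup₂) ⨾ π₁         ≈⟨ ≈.trans assoc (≈.trans (refl⟩⨾⟨ dup₂-π₁) identityʳ) ⟩
            f                       ∎
          same-π₂ : f ⨾ π₂ ≈ g ⨾ π₂
          same-π₂ = begin-equality
            f ⨾ π₂                  ≈⟨ refl⟩⨾⟨ dup₂-π₂ ⟨
            f ⨾ (dup₂ ⨾ π₂)         ≈⟨ ≈.trans sym-assoc (square ⟩⨾⟨refl) ⟩
            (g ⨾ (m ⊗₁ id)) ⨾ π₂    ≈⟨ ≈.trans assoc (refl⟩⨾⟨ map⊗id-π₂ m-map) ⟩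
            g ⨾ π₂                  ∎
          factors-pair : (g ⨾ π₁) ⨾ ⟨ id , m ⨾ π₂ ⟩ ≈ g
          factors-pair = begin-equality
            (g ⨾ π₁) ⨾ ⟨ id , m ⨾ π₂ ⟩
              ≈⟨ pair-natural (map-⨾ g-map map-π₁) ⟩
            ⟨ (g ⨾ π₁) ⨾ id , (g ⨾ π₁) ⨾ (m ⨾ π₂) ⟩
              ≈⟨ pair-cong identityʳ (≈.trans sym-assoc (≈.trans (factors-m ⟩⨾⟨refl) same-π₂)) ⟩
            ⟨ g ⨾ π₁ , g ⨾ π₂ ⟩
              ≈⟨ pair-η g-map ⟩
            g ∎

  -- Consequences of tameness

  module _ (tame : IsTame B) where

    weakPullback⇒op-commutes : (f : Hom V X) (g : Hom V Y) (h : Hom X Z) (k : Hom Y Z) →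
                               IsMap B f → IsMap B g → IsMap B h → IsMap B k →
                               IsWeakPullback B f g h k → h ⨾ op B k ≈ op B f ⨾ g
    weakPullback⇒op-commutes f g h k f-map g-map h-map k-map =
      Equivalence.from (proj₂ tame f g h k f-map g-map h-map k-map)

    op-commutes⇒weakPullback : (f : Hom V X) (g : Hom V Y) (h : Hom X Z) (k : Hom Y Z) →
                               IsMap B f → IsMap B g → IsMap B h → IsMap B k →
                               h ⨾ op B k ≈ op B f ⨾ g → IsWeakPullback B f g h k
    op-commutes⇒weakPullback f g h k f-map g-map h-map k-map =
      Equivalence.to (proj₂ tame f g h k f-map g-map h-map k-map)

    F-comp : (s : Span B X Y) (t : Span B Y Z) → IsSpanOfMaps B s → IsSpanOfMaps B t →
             ∀ {P} (p : Hom P (apex s)) (q : Hom P (apex t)) → IsMap B p → IsMap B q →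
             IsWeakPullback B p q (right s) (left t) →
             F B (compₛ B s t p q) ≈ F B s ⨾ F B t
    F-comp (span _ ls rs) (span _ lt rt) (ls-map , rs-map) (lt-map , _) p q p-map q-map pullback =
      begin-equality
        op B (p ⨾ ls) ⨾ (q ⨾ rt)          ≈⟨ op-⨾ p-map ls-map ⟩⨾⟨refl ⟩
        (op B ls ⨾ op B p) ⨾ (q ⨾ rt)     ≈⟨ ≈.trans assoc (refl⟩⨾⟨ sym-assoc) ⟩
        op B ls ⨾ ((op B p ⨾ q) ⨾ rt)     ≈⟨ refl⟩⨾⟨ (rs⨾op-lt ⟩⨾⟨refl) ⟨
        op B ls ⨾ ((rs ⨾ op B lt) ⨾ rt)   ≈⟨ ≈.trans (refl⟩⨾⟨ assoc) sym-assoc ⟩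
        (op B ls ⨾ rs) ⨾ (op B lt ⨾ rt)   ∎
      where
        rs⨾op-lt : rs ⨾ op B lt ≈ op B p ⨾ q
        rs⨾op-lt = weakPullback⇒op-commutes p q rs lt p-map q-map rs-map lt-map pullback

    op-span≈bend : {m : Hom Z (X ⊗₀ Y)} → IsMap B m → op B (m ⨾ π₁) ⨾ (m ⨾ π₂) ≈ bend (op B m ⨾ ε)
    op-span≈bend {m = m} m-map = begin-equality
      op B (m ⨾ π₁) ⨾ (m ⨾ π₂)                    ≈⟨ op-⨾ m-map map-π₁ ⟩⨾⟨refl ⟩
      (op B π₁ ⨾ op B m) ⨾ (m ⨾ π₂)               ≈⟨ assoc ⟩
      op B π₁ ⨾ op B m ⨾ (m ⨾ π₂)                 ≈⟨ refl⟩⨾⟨ refl⟩⨾⟨ π₂-β map-id ⟨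
      op B π₁ ⨾ op B m ⨾ ⟨ id , m ⨾ π₂ ⟩ ⨾ π₂     ≈⟨ refl⟩⨾⟨ extendˡ square-commutes ⟨
      op B π₁ ⨾ dup₂ ⨾ op B (m ⊗₁ id) ⨾ π₂        ≈⟨ refl⟩⨾⟨ refl⟩⨾⟨ (op-m⊗id ⟩⨾⟨refl) ⟩
      op B π₁ ⨾ dup₂ ⨾ (op B m ⊗₁ id) ⨾ π₂        ≈⟨ bend-op-ε ⟨
      bend (op B m ⨾ ε)                           ∎
      where
        square-commutes : dup₂ ⨾ op B (m ⊗₁ id) ≈ op B m ⨾ ⟨ id , m ⨾ π₂ ⟩
        square-commutes = weakPullback⇒op-commutes m ⟨ id , m ⨾ π₂ ⟩ dup₂ (m ⊗₁ id)
          m-map (map-pair map-id (map-⨾ m-map map-π₂)) map-dup₂ (map-⊗ m-map map-id)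
          (dup₂-square m-map)
        op-m⊗id : op B (m ⊗₁ id) ≈ op B m ⊗₁ id
        op-m⊗id = ≈.trans (op-⊗ m-map map-id) (≈.refl ⟩⊗⟨ op-id)

    F-full : (R : Hom X Y) → Σ (Span B X Y) λ s → IsSpanOfMaps B s × (F B s ≈ R)
    F-full R =
      let Z , m , m-map , name≈ = proj₁ tame ((R ⊗₁ id) ⨾ cap)
      in span Z (m ⨾ π₁) (m ⨾ π₂) , (map-⨾ m-map map-π₁ , map-⨾ m-map map-π₂) , (begin-equality
        op B (m ⨾ π₁) ⨾ (m ⨾ π₂)   ≈⟨ op-span≈bend m-map ⟩
        bend (op B m ⨾ ε)          ≈⟨ bend-cong name≈ ⟨
        bend ((R ⊗₁ id) ⨾ cap)     ≈⟨ bend-name ⟩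
        R                          ∎)

    weakPullbacks-of-maps : HasWeakPullbacksOfMaps B
    weakPullbacks-of-maps h k h-map k-map =
      let span A f g , (f-map , g-map) , F≈ = F-full (h ⨾ op B k)
      in A , f , g , f-map , g-map ,
         op-commutes⇒weakPullback f g h k f-map g-map h-map k-map (≈.sym F≈)

proposition6p6 : ∀ {o ℓ e : Level} (B : CartesianBicategory o ℓ e) →
    IsTame B → FullMorphismFromSpans B
proposition6p6 B tame = record
  { weakPullbacks = weakPullbacks-of-maps B tame
  ; F-mono = F-mono B
  ; F-id = F-idˡ B
  ; F-comp = F-comp B tame
  ; F-⊗ = F-⊗ B
  ; F-σ = F-idˡ B
  ; F-δ = F-idˡ B
  ; F-ε = F-idˡ B
  ; F-δ* = F-right-adjoint B (δ⊣δ* B)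
  ; F-ε* = F-right-adjoint B (ε⊣ε* B)
  ; F-full = F-full B tame
  }
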